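{- Let $G$ be a finite connected graph and let $H_1,\ldots,H_\ell$ be isometric subgraphs of $G$ with $V(G)=\bigcup_{i=1}^\ell V(H_i)$. Let $d\geq1$ and $k\geq2$ be integers. Then $\mathrm{gp}^k_d(G)\leq\sum_{i=1}^\ell\mathrm{gp}^k_d(H_i)$.
   Context: For a graph $G$, a geodesic is a shortest path between two vertices; its length $\lambda(g)$ is its number of edges and $V(g)$ its vertex set. For $d\ge1$, $k\ge2$, $S\subseteq V(G)$ is a $k$-general $d$-position set in $G$ if every geodesic $g$ of $G$ with $|S\cap V(g)|\geq k$ has $\lambda(g)>d$; $\mathrm{gp}^k_d(G)$ is the largest cardinality of such a set. A subgraph $H$ of $G$ is isometric if $d_H(u,v)=d_G(u,v)$ for all $u,v\in V(H)$. -}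

module Defs where

open import Data.Nat using (ℕ; zero; suc; _≤_; _<_; _∸_)
open import Data.Fin using (Fin; _≟_)
open import Data.Fin.Subset using (Subset; _∩_; ∣_∣; _∈_; _⊆_)
open import Data.List using (List; []; _∷_; length)
open import Data.List.Relation.Unary.Any using (any?)
open import Data.Bool using (Bool; true; false)
open import Data.Vec using (Vec)
import Data.Vec as Vec
open import Data.Product using (Σ; _×_; _,_; ∃)
open import Data.Unit using (⊤)
open import Data.Empty using (⊥)
open import Relation.Nullary using (¬_; does)
open import Relation.Binary.PropositionalEquality using (_≡_)
open import Function.Bundles using (_⇔_)

-- The graph G itself uses V = everything; a subgraph H of G uses
-- its own vertex predicate and edge relation.
record GraphOn (n : ℕ) : Set₁ where
  field
    V : Fin n → Set
    E : Fin n → Fin n → Set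

open GraphOn public

record SimpleGraph (n : ℕ) : Set₁ where
  field
    Adj      : Fin n → Fin n → Set
    sym      : ∀ {u v} → Adj u v → Adj v u
    irrefl   : ∀ {u} → ¬ Adj u u

open SimpleGraph public

asGraph : ∀ {n} → SimpleGraph n → GraphOn n
asGraph G = record { V = λ _ → ⊤ ; E = Adj G }

record Subgraph {n : ℕ} (G : SimpleGraph n) : Set₁ where
  field
    VH     : Fin n → Set
    EH     : Fin n → Fin n → Set
    EH-sym : ∀ {u v} → EH u v → EH v u
    EH⊆E   : ∀ {u v} → EH u v → Adj G u v
    EH-ends : ∀ {u v} → EH u v → VH u × VH v

open Subgraph public

subGraph : ∀ {n} {G : SimpleGraph n} → Subgraph G → GraphOn n
subGraph H = record { V = VH H ; E = EH H }

data IsWalkFrom {n : ℕ} (Γ : GraphOn n) : Fin n → List (Fin n) → Set where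
  single : ∀ {u} → V Γ u → IsWalkFrom Γ u []
  step   : ∀ {u w xs} → V Γ u → E Γ u w → IsWalkFrom Γ w xs → IsWalkFrom Γ u (w ∷ xs)

lastV : ∀ {n} → Fin n → List (Fin n) → Fin n
lastV u []       = u
lastV u (w ∷ xs) = lastV w xs

-- A walk from u to v, given as (u , xs) meaning the vertex sequence u ∷ xs.
-- Its length (number of edges) is length xs.
WalkBetween : ∀ {n} → GraphOn n → Fin n → Fin n → List (Fin n) → Set
WalkBetween Γ u v xs = IsWalkFrom Γ u xs × lastV u xs ≡ v

-- A geodesic of Γ: a u,v-walk of minimal length among all u,v-walks in Γ
-- (such a walk is necessarily a path).
IsGeodesic : ∀ {n} → GraphOn n → Fin n → Fin n → List (Fin n) → Set
IsGeodesic Γ u v xs =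
  WalkBetween Γ u v xs × (∀ ys → WalkBetween Γ u v ys → length xs ≤ length ys)

HasDist : ∀ {n} → GraphOn n → Fin n → Fin n → ℕ → Set
HasDist {n} Γ u v m = Σ (List (Fin n)) λ xs → IsGeodesic Γ u v xs × length xs ≡ m

Connected : ∀ {n} → SimpleGraph n → Set
Connected G = ∀ u v → ∃ λ xs → WalkBetween (asGraph G) u v xs

Isometric : ∀ {n} {G : SimpleGraph n} → Subgraph G → Set
Isometric {n} {G} H =
  ∀ u v → VH H u → VH H v → ∀ m → HasDist (subGraph H) u v m ⇔ HasDist (asGraph G) u v m

vertexSet : ∀ {n} → Fin n → List (Fin n) → Subset n
vertexSet u xs = Vec.tabulate λ i → does (any? (i ≟_) (u ∷ xs))

IsKGenDPos : ∀ {n} → GraphOn n → ℕ → ℕ → Subset n → Set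
IsKGenDPos {n} Γ d k S =
  (∀ x → x ∈ S → V Γ x) ×
  (∀ u v xs → IsGeodesic Γ u v xs → k ≤ ∣ S ∩ vertexSet u xs ∣ → d < length xs)

IsGp : ∀ {n} → GraphOn n → ℕ → ℕ → ℕ → Set
IsGp {n} Γ d k m =
  (Σ (Subset n) λ S → IsKGenDPos Γ d k S × ∣ S ∣ ≡ m) ×
  (∀ S → IsKGenDPos Γ d k S → ∣ S ∣ ≤ m)

-- Give every vertex one subgraph H i containing it.  This cuts a maximum
-- k-general d-position set S of G into the pieces S ∩ V(H i).  Since H i is
-- isometric, its geodesics are geodesics of G, so each piece is a k-general
-- d-position set of H i and has at most gp^k_d(H i) elements; summing over
-- the pieces bounds ∣ S ∣.
module Submission where

open import Defs hiding (sym)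
open import Data.Nat using (ℕ; _≤_; _<_; z≤n)
open import Data.Nat.Properties
  using (≤-refl; ≤-trans; ≤-<-trans; +-mono-≤; +-mono-<-≤; +-mono-≤-<; module ≤-Reasoning)
open import Data.Nat.ListAction using (sum)
open import Data.Fin using (Fin; zero; suc; _≟_)
open import Data.Fin.Subset using (Subset; _∩_; ∣_∣; _∈_; _⊆_; inside; outside)
open import Data.Fin.Subset.Properties using (p⊆q⇒∣p∣≤∣q∣; ∣p∣≤∣x∷p∣; p∩q⊆p; x∈p∩q⁺; x∈p∩q⁻)
open import Data.List using (tabulate; length)
open import Data.Vec using (_∷_; [])
import Data.Vec as Vec
open import Data.Vec.Properties using ([]=⇒lookup; lookup∘tabulate)
open import Data.Product using (∃; _,_; proj₁; proj₂)
open import Data.Bool using (true)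
open import Data.Unit using (tt)
open import Function using (_∘_)
open import Function.Bundles using (Equivalence)
open import Relation.Nullary using (Dec; yes; does)
open import Relation.Nullary.Decidable using (dec-true)
open import Relation.Binary.PropositionalEquality using (_≡_; refl; sym; trans; subst)

private
  variable
    n ℓ : ℕ

sum-tabulate-mono-≤ : {a b : Fin ℓ → ℕ} → (∀ i → a i ≤ b i) →
  sum (tabulate a) ≤ sum (tabulate b)
sum-tabulate-mono-≤ {ℓ = ℕ.zero} a≤b = z≤n
sum-tabulate-mono-≤ {ℓ = ℕ.suc _} a≤b = +-mono-≤ (a≤b zero) (sum-tabulate-mono-≤ (a≤b ∘ suc))

sum-tabulate-mono-< : {a b : Fin ℓ → ℕ} → (∀ i → a i ≤ b i) → ∀ j → a j < b j →
  sum (tabulate a) < sum (tabulate b)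
sum-tabulate-mono-< a≤b zero    aj<bj = +-mono-<-≤ aj<bj (sum-tabulate-mono-≤ (a≤b ∘ suc))
sum-tabulate-mono-< a≤b (suc j) aj<bj = +-mono-≤-< (a≤b zero) (sum-tabulate-mono-< (a≤b ∘ suc) j aj<bj)

fiber : (Fin n → Fin ℓ) → Fin ℓ → Subset n
fiber f i = Vec.tabulate λ x → does (f x ≟ i)

does-true⇒ : ∀ {A : Set} (a? : Dec A) → does a? ≡ true → A
does-true⇒ (yes a) _ = a

∈-fiber⁻ : (f : Fin n → Fin ℓ) {i : Fin ℓ} {x : Fin n} → x ∈ fiber f i → f x ≡ i
∈-fiber⁻ f {i} {x} x∈ =
  does-true⇒ (f x ≟ i) (trans (sym (lookup∘tabulate _ x)) ([]=⇒lookup x∈))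

∣p∣≤Σ∣p∩fiber∣ : (f : Fin n → Fin ℓ) (p : Subset n) →
  ∣ p ∣ ≤ sum (tabulate λ i → ∣ p ∩ fiber f i ∣)
∣p∣≤Σ∣p∩fiber∣ f []            = z≤n
∣p∣≤Σ∣p∩fiber∣ f (outside ∷ p) = ∣p∣≤Σ∣p∩fiber∣ (f ∘ suc) p
∣p∣≤Σ∣p∩fiber∣ f (inside ∷ p)  =
  ≤-<-trans (∣p∣≤Σ∣p∩fiber∣ (f ∘ suc) p)
            (sum-tabulate-mono-< (λ i → ∣p∣≤∣x∷p∣ (does (f zero ≟ i)) (p ∩ fiber (f ∘ suc) i))
                                 (f zero) first-in-own-fiber)
  where
  first-in-own-fiber : ∣ p ∩ fiber (f ∘ suc) (f zero) ∣
                     < ∣ does (f zero ≟ f zero) ∷ (p ∩ fiber (f ∘ suc) (f zero)) ∣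
  first-in-own-fiber rewrite dec-true (f zero ≟ f zero) refl = ≤-refl

module _ {G : SimpleGraph n} (H : Subgraph G) where

  sub-walk⇒walk : ∀ {u xs} → IsWalkFrom (subGraph H) u xs → IsWalkFrom (asGraph G) u xs
  sub-walk⇒walk (single _)   = single tt
  sub-walk⇒walk (step _ e w) = step tt (EH⊆E H e) (sub-walk⇒walk w)

  walk-first∈VH : ∀ {u xs} → IsWalkFrom (subGraph H) u xs → VH H u
  walk-first∈VH (single u∈)   = u∈
  walk-first∈VH (step u∈ _ _) = u∈

  walk-last∈VH : ∀ {u xs} → IsWalkFrom (subGraph H) u xs → VH H (lastV u xs)
  walk-last∈VH (single u∈)  = u∈
  walk-last∈VH (step _ _ w) = walk-last∈VH w

  -- Isometry yields some geodesic ys of G with length ys ≡ length xs,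
  -- which transfers the minimality of ys to xs.
  isometric⇒geodesic : Isometric H → ∀ {u v xs} →
    IsGeodesic (subGraph H) u v xs → IsGeodesic (asGraph G) u v xs
  isometric⇒geodesic iso {u} {v} {xs} geo@((w , ends) , _)
    with Equivalence.to (iso u v (walk-first∈VH w) (subst (VH H) ends (walk-last∈VH w)) (length xs))
                        (xs , geo , refl)
  ... | _ , (_ , ys-minimal) , ∣ys∣≡∣xs∣ =
    (sub-walk⇒walk w , ends) , λ zs walk-zs → subst (_≤ length zs) ∣ys∣≡∣xs∣ (ys-minimal zs walk-zs)

IsKGenDPos-restrict : {Γ Δ : GraphOn n} {d k : ℕ} {S T : Subset n} →
  (∀ {u v xs} → IsGeodesic Δ u v xs → IsGeodesic Γ u v xs) →
  IsKGenDPos Γ d k S → T ⊆ S → (∀ x → x ∈ T → V Δ x) → IsKGenDPos Δ d k T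
IsKGenDPos-restrict {S = S} {T} geodesic-Δ⇒Γ (_ , S-pos) T⊆S T⊆VΔ =
  T⊆VΔ , λ u v xs geo k≤ → S-pos u v xs (geodesic-Δ⇒Γ geo) (≤-trans k≤ (p⊆q⇒∣p∣≤∣q∣ T∩g⊆S∩g))
  where
  T∩g⊆S∩g : ∀ {g} → T ∩ g ⊆ S ∩ g
  T∩g⊆S∩g {g} x∈ with x∈p∩q⁻ T g x∈
  ... | x∈T , x∈g = x∈p∩q⁺ (T⊆S x∈T , x∈g)

lemma2p7 : ∀ {n ℓ : ℕ} (G : SimpleGraph n) → Connected G →
    (H : Fin ℓ → Subgraph G) → (∀ i → Isometric (H i)) →
    (∀ v → ∃ λ i → VH (H i) v) →
    ∀ (d k : ℕ) → 1 ≤ d → 2 ≤ k →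
    ∀ (g : ℕ) (gs : Fin ℓ → ℕ) →
    IsGp (asGraph G) d k g → (∀ i → IsGp (subGraph (H i)) d k (gs i)) →
    g ≤ sum (tabulate gs)
lemma2p7 G _ H iso cover d k _ _ g gs ((S , S-pos , ∣S∣≡g) , _) gp-H = begin
  g                                              ≡⟨ sym ∣S∣≡g ⟩
  ∣ S ∣                                          ≤⟨ ∣p∣≤Σ∣p∩fiber∣ owner S ⟩
  sum (tabulate λ i → ∣ S ∩ fiber owner i ∣)     ≤⟨ sum-tabulate-mono-≤ (λ i → proj₂ (gp-H i) _ (piece-pos i)) ⟩
  sum (tabulate gs)                              ∎
  where
  open ≤-Reasoning
  owner : Fin _ → Fin _
  owner x = proj₁ (cover x)
  piece⊆VH : ∀ i x → x ∈ S ∩ fiber owner i → VH (H i) x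
  piece⊆VH i x x∈ =
    subst (λ j → VH (H j) x) (∈-fiber⁻ owner (proj₂ (x∈p∩q⁻ S _ x∈))) (proj₂ (cover x))
  piece-pos : ∀ i → IsKGenDPos (subGraph (H i)) d k (S ∩ fiber owner i)
  piece-pos i = IsKGenDPos-restrict (isometric⇒geodesic (H i) (iso i)) S-pos (p∩q⊆p S _) (piece⊆VH i)
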